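{- Let $n$ and $p$ be integers with $0\leq p\leq \binom{n-1}{2}$. Then every connected graph $G$ with $n$ vertices and $\binom{n}{2}-p$ edges satisfies $mc(G)\geq \binom{n}{2}-2p$.
   Context: All graphs are finite, simple and undirected. For a connected graph $G$, an edge-coloring of $G$ (adjacent edges may receive the same color) is a monochromatic connection coloring (MC-coloring) if any two vertices of $G$ are joined by a path all of whose edges have the same color. The monochromatic connection number $mc(G)$ is the maximum number of colors used in an MC-coloring of $G$. -}

module Defs where

open import Data.Nat using (ℕ; _<ᵇ_; _≥_)
open import Data.Nat.Properties using () renaming (_≟_ to _≟ℕ_)
open import Data.Bool using (Bool; true; false; T; _∧_)
open import Data.Fin using (Fin; toℕ)
open import Data.List using (List; []; _∷_; length; filterᵇ; cartesianProduct; allFin; map; deduplicate)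
open import Data.List.Relation.Unary.Unique.Propositional using (Unique)
open import Data.Product using (_×_; _,_; ∃; proj₁; proj₂)
open import Relation.Binary.PropositionalEquality using (_≡_)
open import Relation.Nullary using (¬_)

record Graph (n : ℕ) : Set where
  field
    adj    : Fin n → Fin n → Bool
    sym    : ∀ i j → adj i j ≡ adj j i
    irrefl : ∀ i → adj i i ≡ false

open Graph public

Adj : ∀ {n} → Graph n → Fin n → Fin n → Set
Adj G i j = T (adj G i j)

-- The list of edges, each edge {i,j} represented once as (i , j) with i < j.
edges : ∀ {n} → Graph n → List (Fin n × Fin n)
edges {n} G =
  filterᵇ (λ e → (toℕ (proj₁ e) <ᵇ toℕ (proj₂ e)) ∧ adj G (proj₁ e) (proj₂ e))
          (cartesianProduct (allFin n) (allFin n))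

numEdges : ∀ {n} → Graph n → ℕ
numEdges G = length (edges G)

data WalkWith {n} (G : Graph n) (Q : Fin n → Fin n → Set) : Fin n → Fin n → Set where
  []  : ∀ {u} → WalkWith G Q u u
  _∷_ : ∀ {u w v} → Adj G u w × Q u w → WalkWith G Q w v → WalkWith G Q u v

vertices : ∀ {n} {G : Graph n} {Q} {u v} → WalkWith G Q u v → List (Fin n)
vertices {u = u} []       = u ∷ []
vertices {u = u} (_ ∷ w)  = u ∷ vertices w

PathWith : ∀ {n} → Graph n → (Fin n → Fin n → Set) → Fin n → Fin n → Set
PathWith G Q u v = ∃ λ (w : WalkWith G Q u v) → Unique (vertices w)

record ⊤' : Set where

Path : ∀ {n} → Graph n → Fin n → Fin n → Set
Path G = PathWith G (λ _ _ → ⊤')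

Connected : ∀ {n} → Graph n → Set
Connected G = ∀ u v → Path G u v

-- An edge-coloring with colors in ℕ: a symmetric function on pairs of
-- vertices; only its values on edges matter.
record EdgeColoring {n} (G : Graph n) : Set where
  field
    color     : Fin n → Fin n → ℕ
    color-sym : ∀ i j → color i j ≡ color j i

open EdgeColoring public

MonoPath : ∀ {n} {G : Graph n} → EdgeColoring G → ℕ → Fin n → Fin n → Set
MonoPath {G = G} c k = PathWith G (λ i j → color c i j ≡ k)

IsMC : ∀ {n} {G : Graph n} → EdgeColoring G → Set
IsMC {n} c = ∀ (u v : Fin n) → ∃ λ k → MonoPath c k u v

numColors : ∀ {n} {G : Graph n} → EdgeColoring G → ℕ
numColors {G = G} c =
  length (deduplicate _≟ℕ_ (map (λ e → color c (proj₁ e) (proj₂ e)) (edges G)))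

mc≥ : ∀ {n} → Graph n → ℕ → Set
mc≥ G m = ∃ λ (c : EdgeColoring G) → IsMC c × numColors c ≥ m

-- Let m = C(n,2) − p. If p ≥ n − 1, colour a spanning tree with colour 0 and give every
-- other edge its own colour: this is an MC-colouring with at least m − (n − 1) ≥ C(n,2) − 2p
-- colours. If p < n − 1, any two non-adjacent vertices a, b have a common neighbour: otherwise
-- every x ≠ a is non-adjacent to a, or else to b, and these n − 1 non-edges are distinct.
-- Then start from distinct colours on all edges and, for each non-edge ab with common neighbour
-- w, recolour the class of wb with the colour of aw. Each of the p merges loses at most one
-- colour, so at least m − p = C(n,2) − 2p colours remain, and every non-edge is spanned by a
-- monochromatic path of length two.
module Submission where

open import Defs
open import Data.Nat using (ℕ; _≤_; _∸_; _*_)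
open import Data.Nat.Combinatorics using (_C_)
open import Relation.Binary.PropositionalEquality using (_≡_)

open import Data.Bool using (Bool; true; false; T; not; _∧_; if_then_else_)
open import Data.Bool.Properties using (T-∧; T?)
open import Data.Empty using (⊥-elim)
open import Data.Fin as Fin using (Fin; toℕ; combine; punchIn)
import Data.Fin.Properties as Finₚ
open import Data.List using (List; []; _∷_; length; map; filterᵇ; cartesianProduct; allFin; deduplicate; _++_)
open import Data.List.Properties using (length-removeAt′; map-cong-local; map-∘; length-map; filter-++; length-++; map-tabulate; length-tabulate)
open import Data.List.Membership.Propositional using (_∈_)
open import Data.List.Membership.Propositional.Properties using (∈-map⁺; ∈-map⁻; ∈-filter⁺; ∈-filter⁻; ∈-deduplicate⁺; ∈-deduplicate⁻; ∈-cartesianProduct⁺; ∈-allFin)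
open import Data.List.Relation.Binary.Subset.Propositional using (_⊆_)
open import Data.List.Relation.Unary.All as All using (All; []; _∷_)
open import Data.List.Relation.Unary.Any as Any using (here; there; index; _─_)
open import Data.List.Relation.Unary.All.Properties using (¬Any⇒All¬)
open import Data.List.Relation.Unary.Unique.Propositional using (Unique; []; _∷_)
import Data.List.Relation.Unary.Unique.Propositional.Properties as Uniqueₚ
open import Data.List.Relation.Unary.Unique.DecPropositional.Properties using (deduplicate-!)
open import Data.Nat using (zero; suc; _+_; _<_; z≤n; s≤s; _<ᵇ_; _≤?_)
open import Data.Nat.Properties
open import Data.Nat.Combinatorics using (nC1≡n; nCk+nC[k+1]≡[n+1]C[k+1])
open import Data.Product using (_×_; _,_; ∃; ∃₂; proj₁; proj₂)
open import Data.Sum using (_⊎_; inj₁; inj₂)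
open import Data.Unit using (tt)
open import Function using (_∘_; id; Equivalence)
open import Relation.Nullary using (¬_; yes; no)
open import Relation.Nullary.Decidable using (_×-dec_)
open import Relation.Binary.PropositionalEquality as ≡ using (refl; trans; cong; cong₂; subst; _≢_; ≢-sym; module ≡-Reasoning)

∈-─ : {A : Set} {x y : A} {zs : List A} (y∈zs : y ∈ zs) → x ∈ zs → x ≢ y → x ∈ (zs ─ y∈zs)
∈-─ (here refl)  (here refl)  x≢y = ⊥-elim (x≢y refl)
∈-─ (here refl)  (there x∈zs) _   = x∈zs
∈-─ (there _)    (here refl)  _   = here refl
∈-─ (there y∈zs) (there x∈zs) x≢y = there (∈-─ y∈zs x∈zs x≢y)

Unique-⊆⇒length≤ : {A : Set} {ys zs : List A} → Unique ys → ys ⊆ zs → length ys ≤ length zs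
Unique-⊆⇒length≤ {ys = []}     _             _      = z≤n
Unique-⊆⇒length≤ {ys = y ∷ ys} {zs} (y∉ys ∷ ys!) y∷ys⊆zs =
  subst (suc (length ys) ≤_) (≡.sym (length-removeAt′ zs (index y∈zs)))
    (s≤s (Unique-⊆⇒length≤ ys! λ x∈ys →
      ∈-─ y∈zs (y∷ys⊆zs (there x∈ys)) (≢-sym (All.lookup y∉ys x∈ys))))
  where y∈zs = y∷ys⊆zs (here refl)

distinct : List ℕ → ℕ
distinct xs = length (deduplicate _≟_ xs)

distinct≤length : ∀ xs → distinct xs ≤ length xs
distinct≤length xs = Unique-⊆⇒length≤ (deduplicate-! _≟_ xs) (∈-deduplicate⁻ _≟_ xs)

Unique⇒length≤distinct : ∀ {xs} → Unique xs → length xs ≤ distinct xs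
Unique⇒length≤distinct xs! = Unique-⊆⇒length≤ xs! (∈-deduplicate⁺ _≟_)

recolour : ℕ → ℕ → ℕ → ℕ
recolour a b x with x ≟ a
... | yes _ = b
... | no  _ = x

recolour-source : ∀ a b → recolour a b a ≡ b
recolour-source a b with a ≟ a
... | yes _   = refl
... | no  a≢a = ⊥-elim (a≢a refl)

recolour-target : ∀ a b → recolour a b b ≡ b
recolour-target a b with b ≟ a
... | yes _ = refl
... | no  _ = refl

recolour-≢ : ∀ {a b x} → x ≢ a → recolour a b x ≡ x
recolour-≢ {a} {x = x} x≢a with x ≟ a
... | yes x≡a = ⊥-elim (x≢a x≡a)
... | no  _   = refl

recolour-≢-source : ∀ {a b} x → a ≢ b → recolour a b x ≢ a
recolour-≢-source {a} x a≢b with x ≟ a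
... | yes _   = ≢-sym a≢b
... | no  x≢a = x≢a

recolour-≡ : ∀ {a b} x y → recolour a b x ≡ recolour a b y →
             x ≡ y ⊎ (x ≡ a × y ≡ b) ⊎ (x ≡ b × y ≡ a)
recolour-≡ {a} x y eq with x ≟ a | y ≟ a
... | yes x≡a | yes y≡a = inj₁ (trans x≡a (≡.sym y≡a))
... | yes x≡a | no  _   = inj₂ (inj₁ (x≡a , ≡.sym eq))
... | no  _   | yes y≡a = inj₂ (inj₂ (eq , y≡a))
... | no  _   | no  _   = inj₁ eq

distinct-recolour : ∀ a b xs → distinct xs ≤ suc (distinct (map (recolour a b) xs))
distinct-recolour a b xs = Unique-⊆⇒length≤ (deduplicate-! _≟_ xs) kept
  where
  kept : deduplicate _≟_ xs ⊆ a ∷ deduplicate _≟_ (map (recolour a b) xs)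
  kept {x} x∈ with x ≟ a
  ... | yes refl = here refl
  ... | no  x≢a  = there (∈-deduplicate⁺ _≟_ (subst (_∈ map (recolour a b) xs) (recolour-≢ x≢a)
                     (∈-map⁺ (recolour a b) (∈-deduplicate⁻ _≟_ xs x∈))))

distinct-recolour-merge : ∀ {a b} xs → a ∈ xs → b ∈ xs → a ≢ b →
                          suc (distinct (map (recolour a b) xs)) ≤ distinct xs
distinct-recolour-merge {a} {b} xs a∈xs b∈xs a≢b =
  Unique-⊆⇒length≤ (All.tabulate a-fresh ∷ deduplicate-! _≟_ ys) merged
  where
  ys = map (recolour a b) xs
  a-fresh : ∀ {y} → y ∈ deduplicate _≟_ ys → a ≢ y
  a-fresh y∈ with ∈-map⁻ (recolour a b) (∈-deduplicate⁻ _≟_ ys y∈)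
  ... | x , _ , refl = ≢-sym (recolour-≢-source x a≢b)
  merged : a ∷ deduplicate _≟_ ys ⊆ deduplicate _≟_ xs
  merged (here refl) = ∈-deduplicate⁺ _≟_ a∈xs
  merged (there y∈) with ∈-map⁻ (recolour a b) (∈-deduplicate⁻ _≟_ ys y∈)
  ... | x , x∈xs , refl with x ≟ a
  ...   | yes _ = ∈-deduplicate⁺ _≟_ b∈xs
  ...   | no  _ = ∈-deduplicate⁺ _≟_ x∈xs

module _ {n} {G : Graph n} where

  Adj-sym : ∀ {u v} → Adj G u v → Adj G v u
  Adj-sym {u} {v} = subst T (Graph.sym G u v)

  Adj⇒≢ : ∀ {u v} → Adj G u v → u ≢ v
  Adj⇒≢ {u} u~u refl = subst T (irrefl G u) u~u

  mapWalk : ∀ {Q R : Fin n → Fin n → Set} → (∀ {i j} → Q i j → R i j) →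
            ∀ {u v} → WalkWith G Q u v → WalkWith G R u v
  mapWalk f []             = []
  mapWalk f ((u~w , q) ∷ w) = (u~w , f q) ∷ mapWalk f w

  _++ʷ_ : ∀ {Q u v x} → WalkWith G Q u v → WalkWith G Q v x → WalkWith G Q u x
  []      ++ʷ w′ = w′
  (e ∷ w) ++ʷ w′ = e ∷ (w ++ʷ w′)

  suffixPath : ∀ {Q x v} (w : WalkWith G Q x v) {u} → u ∈ vertices w → Unique (vertices w) →
               PathWith G Q u v
  suffixPath []      (here refl) w! = [] , w!
  suffixPath (e ∷ w) (here refl) w! = e ∷ w , w!
  suffixPath (e ∷ w) (there u∈w) (_ ∷ w!) = suffixPath w u∈w w!

  walk⇒path : ∀ {Q u v} → WalkWith G Q u v → PathWith G Q u v
  walk⇒path []  = [] , [] ∷ []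
  walk⇒path {u = u} (e ∷ w) with walk⇒path w
  ... | p , p! with Any.any? (u Finₚ.≟_) (vertices p)
  ...   | yes u∈p = suffixPath p u∈p p!
  ...   | no  u∉p = e ∷ p , ¬Any⇒All¬ _ u∉p ∷ p!

module _ {n : ℕ} where

  sortPair : Fin n → Fin n → Fin n × Fin n
  sortPair i j with i Finₚ.<? j
  ... | yes _ = i , j
  ... | no  _ = j , i

  sortPair-comm : ∀ i j → sortPair i j ≡ sortPair j i
  sortPair-comm i j with i Finₚ.<? j | j Finₚ.<? i
  ... | yes i<j | yes j<i = ⊥-elim (<-asym i<j j<i)
  ... | yes _   | no  _   = refl
  ... | no  _   | yes _   = refl
  ... | no  i≮j | no  j≮i with Finₚ.toℕ-injective (≤-antisym (≮⇒≥ j≮i) (≮⇒≥ i≮j))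
  ...   | refl = refl

  sortPair-cases : ∀ i j → sortPair i j ≡ (i , j) ⊎ sortPair i j ≡ (j , i)
  sortPair-cases i j with i Finₚ.<? j
  ... | yes _ = inj₁ refl
  ... | no  _ = inj₂ refl

  sortPair-< : ∀ {i j} → i ≢ j → toℕ (proj₁ (sortPair i j)) < toℕ (proj₂ (sortPair i j))
  sortPair-< {i} {j} i≢j with i Finₚ.<? j
  ... | yes i<j = i<j
  ... | no  i≮j with m≤n⇒m<n∨m≡n (≮⇒≥ i≮j)
  ...   | inj₁ j<i = j<i
  ...   | inj₂ j≡i = ⊥-elim (i≢j (Finₚ.toℕ-injective (≡.sym j≡i)))

  sortPair-of-< : ∀ {i j} → toℕ i < toℕ j → sortPair i j ≡ (i , j)
  sortPair-of-< {i} {j} i<j with i Finₚ.<? j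
  ... | yes _   = refl
  ... | no  i≮j = ⊥-elim (i≮j i<j)

  sortPair-injective : ∀ {x a y b} → sortPair x a ≡ sortPair y b → (x ≡ y × a ≡ b) ⊎ (x ≡ b × a ≡ y)
  sortPair-injective {x} {a} {y} {b} eq with x Finₚ.<? a | y Finₚ.<? b | eq
  ... | yes _ | yes _ | refl = inj₁ (refl , refl)
  ... | yes _ | no  _ | refl = inj₂ (refl , refl)
  ... | no  _ | yes _ | refl = inj₂ (refl , refl)
  ... | no  _ | no  _ | refl = inj₁ (refl , refl)

  ordered : Fin n × Fin n → Bool
  ordered e = toℕ (proj₁ e) <ᵇ toℕ (proj₂ e)

  allPairs : List (Fin n × Fin n)
  allPairs = cartesianProduct (allFin n) (allFin n)

  pairsWhere : (Fin n → Fin n → Bool) → List (Fin n × Fin n)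
  pairsWhere P = filterᵇ (λ e → ordered e ∧ P (proj₁ e) (proj₂ e)) allPairs

  module _ {P : Fin n → Fin n → Bool} where

    pairsWhere-Unique : Unique (pairsWhere P)
    pairsWhere-Unique = Uniqueₚ.filter⁺ _ (Uniqueₚ.cartesianProduct⁺ (Uniqueₚ.allFin⁺ n) (Uniqueₚ.allFin⁺ n))

    ∈-pairsWhere⁻ : ∀ {i j} → (i , j) ∈ pairsWhere P → toℕ i < toℕ j × T (P i j)
    ∈-pairsWhere⁻ {i} {j} m with Equivalence.to T-∧ (proj₂ (∈-filter⁻ (T? ∘ _) {xs = allPairs} m))
    ... | i<j , Pij = <ᵇ⇒< (toℕ i) (toℕ j) i<j , Pij

    ∈-pairsWhere⁺ : ∀ {i j} → toℕ i < toℕ j → T (P i j) → (i , j) ∈ pairsWhere P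
    ∈-pairsWhere⁺ {i} {j} i<j Pij =
      ∈-filter⁺ (T? ∘ _) (∈-cartesianProduct⁺ (∈-allFin i) (∈-allFin j)) (Equivalence.from T-∧ (<⇒<ᵇ i<j , Pij))

    module _ (P-sym : ∀ i j → P i j ≡ P j i) where

      sortPair-∈-pairsWhere : ∀ {i j} → i ≢ j → T (P i j) → sortPair i j ∈ pairsWhere P
      sortPair-∈-pairsWhere {i} {j} i≢j Pij with sortPair i j | sortPair-cases i j | sortPair-< i≢j
      ... | _ | inj₁ refl | i<j = ∈-pairsWhere⁺ i<j Pij
      ... | _ | inj₂ refl | j<i = ∈-pairsWhere⁺ j<i (subst T (P-sym i j) Pij)

      ∈-pairsWhere-unordered : ∀ {i j} → i ≢ j → T (P i j) → (i , j) ∈ pairsWhere P ⊎ (j , i) ∈ pairsWhere P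
      ∈-pairsWhere-unordered {i} {j} i≢j Pij with sortPair i j | sortPair-cases i j | sortPair-∈-pairsWhere i≢j Pij
      ... | _ | inj₁ refl | m = inj₁ m
      ... | _ | inj₂ refl | m = inj₂ m

count : {A : Set} → (A → Bool) → List A → ℕ
count p xs = length (filterᵇ p xs)

count-++ : {A : Set} (p : A → Bool) (xs ys : List A) → count p (xs ++ ys) ≡ count p xs + count p ys
count-++ p xs ys = trans (cong length (filter-++ (T? ∘ p) xs ys)) (length-++ (filterᵇ p xs))

count-∧-not : {A : Set} (p q : A → Bool) (xs : List A) →
              count (λ x → p x ∧ q x) xs + count (λ x → p x ∧ not (q x)) xs ≡ count p xs
count-∧-not p q [] = refl
count-∧-not p q (x ∷ xs) with p x | q x
... | false | _     = count-∧-not p q xs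
... | true  | true  = cong suc (count-∧-not p q xs)
... | true  | false = trans (+-suc _ _) (cong suc (count-∧-not p q xs))

allFin-suc : ∀ k → allFin (suc k) ≡ Fin.zero ∷ map Fin.suc (allFin k)
allFin-suc k = cong (Fin.zero ∷_) (≡.sym (map-tabulate id Fin.suc))

count-ordered-zero : ∀ {k} (ys : List (Fin k)) →
                     count ordered (map (Fin.zero ,_) (map Fin.suc ys)) ≡ length ys
count-ordered-zero []       = refl
count-ordered-zero (y ∷ ys) = cong suc (count-ordered-zero ys)

count-ordered-suc : ∀ {k} (x : Fin k) ys →
                    count ordered (map (Fin.suc x ,_) (map Fin.suc ys)) ≡ count ordered (map (x ,_) ys)
count-ordered-suc x []       = refl
count-ordered-suc x (y ∷ ys) with toℕ x <ᵇ toℕ y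
... | true  = cong suc (count-ordered-suc x ys)
... | false = count-ordered-suc x ys

count-ordered-shift : ∀ {k} (xs ys : List (Fin k)) →
  count ordered (cartesianProduct (map Fin.suc xs) (Fin.zero ∷ map Fin.suc ys)) ≡ count ordered (cartesianProduct xs ys)
count-ordered-shift []       ys = refl
count-ordered-shift (x ∷ xs) ys = begin
  count ordered (map (Fin.suc x ,_) (map Fin.suc ys) ++ cartesianProduct (map Fin.suc xs) (Fin.zero ∷ map Fin.suc ys))
    ≡⟨ count-++ ordered (map (Fin.suc x ,_) (map Fin.suc ys)) _ ⟩
  count ordered (map (Fin.suc x ,_) (map Fin.suc ys)) + count ordered (cartesianProduct (map Fin.suc xs) (Fin.zero ∷ map Fin.suc ys))
    ≡⟨ cong₂ _+_ (count-ordered-suc x ys) (count-ordered-shift xs ys) ⟩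
  count ordered (map (x ,_) ys) + count ordered (cartesianProduct xs ys)
    ≡⟨ count-++ ordered (map (x ,_) ys) _ ⟨
  count ordered (cartesianProduct (x ∷ xs) ys) ∎
  where open ≡-Reasoning

count-ordered-allPairs : ∀ n → count ordered (allPairs {n}) ≡ n C 2
count-ordered-allPairs zero    = refl
count-ordered-allPairs (suc k) = begin
  count ordered (cartesianProduct (allFin (suc k)) (allFin (suc k)))
    ≡⟨ cong (λ zs → count ordered (cartesianProduct zs zs)) (allFin-suc k) ⟩
  count ordered (map (Fin.zero ,_) (map Fin.suc xs) ++ cartesianProduct (map Fin.suc xs) (Fin.zero ∷ map Fin.suc xs))
    ≡⟨ count-++ ordered (map (Fin.zero ,_) (map Fin.suc xs)) _ ⟩
  count ordered (map (Fin.zero ,_) (map Fin.suc xs)) + count ordered (cartesianProduct (map Fin.suc xs) (Fin.zero ∷ map Fin.suc xs))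
    ≡⟨ cong₂ _+_ (count-ordered-zero xs) (count-ordered-shift xs xs) ⟩
  length xs + count ordered (allPairs {k})
    ≡⟨ cong₂ _+_ (trans (length-tabulate id) (≡.sym (nC1≡n k))) (count-ordered-allPairs k) ⟩
  k C 1 + k C 2
    ≡⟨ nCk+nC[k+1]≡[n+1]C[k+1] k 1 ⟩
  suc k C 2 ∎
  where
  open ≡-Reasoning
  xs = allFin k

pairsWhere-complement : ∀ {n} (P : Fin n → Fin n → Bool) →
  length (pairsWhere P) + length (pairsWhere (λ i j → not (P i j))) ≡ n C 2
pairsWhere-complement {n} P =
  trans (count-∧-not ordered (λ e → P (proj₁ e) (proj₂ e)) allPairs) (count-ordered-allPairs n)

T-not⁺ : ∀ {b} → ¬ T b → T (not b)
T-not⁺ {true}  ¬b = ¬b tt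
T-not⁺ {false} _  = tt

T-not⁻ : ∀ {b} → T (not b) → ¬ T b
T-not⁻ {true}  ()
T-not⁻ {false} _ ()

-- Codes start at 1, leaving colour 0 free for a spanning tree.
pairCode : ∀ {n} → Fin n × Fin n → ℕ
pairCode (i , j) = suc (toℕ (combine i j))

pairCode-injective : ∀ {n} {e e′ : Fin n × Fin n} → pairCode e ≡ pairCode e′ → e ≡ e′
pairCode-injective {e = i , j} {k , l} eq = cong₂ _,_
  (Finₚ.combine-injectiveˡ i j k l ij≡kl) (Finₚ.combine-injectiveʳ i j k l ij≡kl)
  where ij≡kl = Finₚ.toℕ-injective (suc-injective eq)

module _ {n} (G : Graph n) where

  nonEdges : List (Fin n × Fin n)
  nonEdges = pairsWhere (λ i j → not (adj G i j))

  numEdges+nonEdges : numEdges G + length nonEdges ≡ n C 2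
  numEdges+nonEdges = pairsWhere-complement (adj G)

  nonadj-sym : ∀ i j → not (adj G i j) ≡ not (adj G j i)
  nonadj-sym i j = cong not (Graph.sym G i j)

  codeColouring : EdgeColoring G
  codeColouring = record
    { color     = λ i j → pairCode (sortPair i j)
    ; color-sym = λ i j → cong pairCode (sortPair-comm i j)
    }

  numEdges≤numColors-code : numEdges G ≤ numColors codeColouring
  numEdges≤numColors-code = subst (_≤ numColors codeColouring) (length-map _ (edges G))
    (Unique⇒length≤distinct (subst Unique (≡.sym codes) (Uniqueₚ.map⁺ pairCode-injective pairsWhere-Unique)))
    where
    codes : map (λ e → pairCode (sortPair (proj₁ e) (proj₂ e))) (edges G) ≡ map pairCode (edges G)
    codes = map-cong-local (All.tabulate λ e∈ → cong pairCode (sortPair-of-< (proj₁ (∈-pairsWhere⁻ e∈))))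

  recolouring : EdgeColoring G → ℕ → ℕ → EdgeColoring G
  recolouring c a b = record
    { color     = λ i j → recolour a b (color c i j)
    ; color-sym = λ i j → cong (recolour a b) (color-sym c i j)
    }

  numColors-recolouring : ∀ c a b → numColors c ≤ suc (numColors (recolouring c a b))
  numColors-recolouring c a b =
    subst (λ cs → numColors c ≤ suc (distinct cs)) (≡.sym (map-∘ (edges G)))
      (distinct-recolour a b (map (λ e → color c (proj₁ e) (proj₂ e)) (edges G)))

numValues : ∀ {n} → (Fin n → ℕ) → ℕ
numValues {n} f = distinct (map f (allFin n))

n≤numValues+n∸1 : ∀ {n} (f : Fin n → ℕ) → n ≤ numValues f + (n ∸ 1)
n≤numValues+n∸1 {zero}  f = z≤n
n≤numValues+n∸1 {suc k} f = s≤s (m≤n+m k _)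

module SpanningForest {n} (G : Graph n) where

  ZeroWalk : EdgeColoring G → Fin n → Fin n → Set
  ZeroWalk c = WalkWith G (λ i j → color c i j ≡ 0)

  -- comp labels the connected components of the subgraph formed by the edges of colour 0.
  record Forest (comp : Fin n → ℕ) (c : EdgeColoring G) (es : List (Fin n × Fin n)) : Set where
    field
      zeroWalk : ∀ x y → comp x ≡ comp y → ZeroWalk c x y
      spans    : ∀ {u v} → (u , v) ∈ es → comp u ≡ comp v
      budget   : numEdges G + numValues comp ≤ numColors c + n
  open Forest

  emptyForest : Forest (toℕ {n}) (codeColouring G) []
  emptyForest = record
    { zeroWalk = λ x y x≡y → subst (ZeroWalk (codeColouring G) x) (Finₚ.toℕ-injective x≡y) []
    ; spans    = λ ()
    ; budget   = +-mono-≤ (numEdges≤numColors-code G) values≤n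
    }
    where
    values≤n : numValues (toℕ {n}) ≤ n
    values≤n = subst (numValues (toℕ {n}) ≤_) (trans (length-map toℕ (allFin n)) (length-tabulate id))
                     (distinct≤length (map toℕ (allFin n)))

  addEdge : ∀ {comp c es u v} → Adj G u v → comp u ≢ comp v → Forest comp c es →
            Forest (recolour (comp u) (comp v) ∘ comp) (recolouring G c (color c u v) 0) ((u , v) ∷ es)
  addEdge {comp} {c} {es} {u} {v} u~v split F = record
    { zeroWalk = zeroWalk′
    ; spans    = spans′
    ; budget   = budget′
    }
    where
    c′ = recolouring G c (color c u v) 0
    comp′ = recolour (comp u) (comp v) ∘ comp

    keep : ∀ {x y} → ZeroWalk c x y → ZeroWalk c′ x y
    keep = mapWalk λ cij≡0 → trans (cong (recolour _ 0) cij≡0) (recolour-target _ 0)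

    u→v : ZeroWalk c′ u v
    u→v = (u~v , recolour-source (color c u v) 0) ∷ []

    v→u : ZeroWalk c′ v u
    v→u = (Adj-sym {G = G} u~v , trans (cong (recolour _ 0) (color-sym c v u)) (recolour-source (color c u v) 0)) ∷ []

    zeroWalk′ : ∀ x y → comp′ x ≡ comp′ y → ZeroWalk c′ x y
    zeroWalk′ x y eq with recolour-≡ (comp x) (comp y) eq
    ... | inj₁ same                 = keep (zeroWalk F x y same)
    ... | inj₂ (inj₁ (x≡u , y≡v)) = keep (zeroWalk F x u x≡u) ++ʷ (u→v ++ʷ keep (zeroWalk F v y (≡.sym y≡v)))
    ... | inj₂ (inj₂ (x≡v , y≡u)) = keep (zeroWalk F x v x≡v) ++ʷ (v→u ++ʷ keep (zeroWalk F u y (≡.sym y≡u)))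

    spans′ : ∀ {x y} → (x , y) ∈ (u , v) ∷ es → comp′ x ≡ comp′ y
    spans′ (here refl) = trans (recolour-source (comp u) (comp v)) (≡.sym (recolour-target (comp u) (comp v)))
    spans′ (there e∈es) = cong (recolour (comp u) (comp v)) (spans F e∈es)

    fewerValues : suc (numValues comp′) ≤ numValues comp
    fewerValues = subst (λ vs → suc (distinct vs) ≤ numValues comp) (≡.sym (map-∘ (allFin n)))
      (distinct-recolour-merge (map comp (allFin n)) (∈-map⁺ comp (∈-allFin u)) (∈-map⁺ comp (∈-allFin v)) split)

    budget′ : numEdges G + numValues comp′ ≤ numColors c′ + n
    budget′ = ≤-pred (begin
      suc (numEdges G + numValues comp′) ≡⟨ +-suc (numEdges G) _ ⟨
      numEdges G + suc (numValues comp′) ≤⟨ +-monoʳ-≤ (numEdges G) fewerValues ⟩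
      numEdges G + numValues comp        ≤⟨ budget F ⟩
      numColors c + n                    ≤⟨ +-monoˡ-≤ n (numColors-recolouring G c (color c u v) 0) ⟩
      suc (numColors c′ + n)             ∎)
      where open ≤-Reasoning

  forest : ∀ es → (∀ {u v} → (u , v) ∈ es → Adj G u v) → ∃₂ λ comp c → Forest comp c es
  forest [] _ = toℕ , codeColouring G , emptyForest
  forest ((u , v) ∷ es) es⊆E with forest es (es⊆E ∘ there)
  ... | comp , c , F with comp u ≟ comp v
  ...   | no  split = _ , _ , addEdge (es⊆E (here refl)) split F
  ...   | yes same  = comp , c , record
                        { zeroWalk = zeroWalk F
                        ; spans    = λ { (here refl) → same ; (there e∈es) → spans F e∈es }
                        ; budget   = budget F
                        }

spanningTreeColouring : ∀ {n} (G : Graph n) → Connected G →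
                        ∃ λ (c : EdgeColoring G) → IsMC c × numEdges G ≤ numColors c + (n ∸ 1)
spanningTreeColouring {n} G connected with SpanningForest.forest G (edges G) (proj₂ ∘ ∈-pairsWhere⁻)
... | comp , c , F = c , mono , bound
  where
  open SpanningForest G
  open Forest F

  comp-walk : ∀ {Q x y} → WalkWith G Q x y → comp x ≡ comp y
  comp-walk [] = refl
  comp-walk ((u~w , _) ∷ w) with ∈-pairsWhere-unordered (Graph.sym G) (Adj⇒≢ {G = G} u~w) u~w
  ... | inj₁ uw∈E = trans (spans uw∈E) (comp-walk w)
  ... | inj₂ wu∈E = trans (≡.sym (spans wu∈E)) (comp-walk w)

  mono : IsMC c
  mono u v = 0 , walk⇒path (zeroWalk u v (comp-walk (proj₁ (connected u v))))

  bound : numEdges G ≤ numColors c + (n ∸ 1)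
  bound = +-cancelʳ-≤ (numValues comp) _ _ (begin
    numEdges G + numValues comp              ≤⟨ budget ⟩
    numColors c + n                          ≤⟨ +-monoʳ-≤ (numColors c) (n≤numValues+n∸1 comp) ⟩
    numColors c + (numValues comp + (n ∸ 1)) ≡⟨ cong (numColors c +_) (+-comm (numValues comp) _) ⟩
    numColors c + ((n ∸ 1) + numValues comp) ≡⟨ +-assoc (numColors c) _ _ ⟨
    numColors c + (n ∸ 1) + numValues comp   ∎)
    where open ≤-Reasoning

module _ {n} (G : Graph n) where

  CommonNeighbour : Fin n × Fin n → Set
  CommonNeighbour (a , b) = ∃ λ w → Adj G a w × Adj G w b

  DiameterAtMostTwo : Set
  DiameterAtMostTwo = ∀ {a b} → a ≢ b → ¬ Adj G a b → CommonNeighbour (a , b)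

  MonoTwoPath : EdgeColoring G → Fin n × Fin n → Set
  MonoTwoPath c (a , b) = ∃ λ w → Adj G a w × Adj G w b × color c a w ≡ color c w b

  MonoTwoPath-swap : ∀ {c a b} → MonoTwoPath c (a , b) → MonoTwoPath c (b , a)
  MonoTwoPath-swap {c} {a} {b} (w , a~w , w~b , same) =
    w , Adj-sym {G = G} w~b , Adj-sym {G = G} a~w ,
    trans (color-sym c b w) (trans (≡.sym same) (color-sym c a w))

  MonoTwoPath⇒MonoPath : ∀ {c a b} → MonoTwoPath c (a , b) → ∃ λ k → MonoPath c k a b
  MonoTwoPath⇒MonoPath {c} {a} (w , a~w , w~b , same) =
    color c a w , walk⇒path ((a~w , refl) ∷ (w~b , ≡.sym same) ∷ [])

  twoPathColouring : ∀ es → All CommonNeighbour es →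
    ∃ λ (c : EdgeColoring G) → All (MonoTwoPath c) es × numEdges G ≤ numColors c + length es
  twoPathColouring [] [] = codeColouring G , [] , ≤-trans (numEdges≤numColors-code G) (m≤m+n _ 0)
  twoPathColouring ((a , b) ∷ es) ((w , a~w , w~b) ∷ cns) with twoPathColouring es cns
  ... | c , monos , budget = c′ , new ∷ All.map keep monos , budget′
    where
    c′ = recolouring G c (color c w b) (color c a w)

    new : MonoTwoPath c′ (a , b)
    new = w , a~w , w~b , trans (recolour-target (color c w b) (color c a w)) (≡.sym (recolour-source (color c w b) (color c a w)))

    keep : ∀ {e} → MonoTwoPath c e → MonoTwoPath c′ e
    keep (x , p , q , same) = x , p , q , cong (recolour _ _) same

    budget′ : numEdges G ≤ numColors c′ + suc (length es)
    budget′ = begin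
      numEdges G                    ≤⟨ budget ⟩
      numColors c + length es       ≤⟨ +-monoˡ-≤ (length es) (numColors-recolouring G c _ _) ⟩
      suc (numColors c′) + length es ≡⟨ +-suc (numColors c′) (length es) ⟨
      numColors c′ + suc (length es) ∎
      where open ≤-Reasoning

  diameterTwoColouring : DiameterAtMostTwo →
    ∃ λ (c : EdgeColoring G) → IsMC c × numEdges G ≤ numColors c + length (nonEdges G)
  diameterTwoColouring diam with twoPathColouring (nonEdges G) (All.tabulate nonEdge⇒CommonNeighbour)
    where
    nonEdge⇒CommonNeighbour : ∀ {e} → e ∈ nonEdges G → CommonNeighbour e
    nonEdge⇒CommonNeighbour e∈ with ∈-pairsWhere⁻ e∈
    ... | a<b , a≁b = diam (λ { refl → <-irrefl refl a<b }) (T-not⁻ a≁b)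
  ... | c , monos , budget = c , mono , budget
    where
    mono : IsMC c
    mono u v with u Finₚ.≟ v
    ... | yes refl = 0 , [] , [] ∷ []
    ... | no  u≢v with T? (adj G u v)
    ...   | yes u~v = color c u v , walk⇒path ((u~v , refl) ∷ [])
    ...   | no  u≁v with ∈-pairsWhere-unordered (nonadj-sym G) u≢v (T-not⁺ u≁v)
    ...     | inj₁ uv∈N = MonoTwoPath⇒MonoPath {c = c} (All.lookup monos uv∈N)
    ...     | inj₂ vu∈N = MonoTwoPath⇒MonoPath {c = c} (MonoTwoPath-swap {c = c} (All.lookup monos vu∈N))

far⇒n∸1≤nonEdges : ∀ {n} (G : Graph n) {a b} → a ≢ b → ¬ Adj G a b → ¬ CommonNeighbour G (a , b) →
                   n ∸ 1 ≤ length (nonEdges G)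
far⇒n∸1≤nonEdges {zero}  G {()}
far⇒n∸1≤nonEdges {suc k} G {a} {b} a≢b a≁b lonely =
  subst (_≤ length (nonEdges G)) (trans (length-map pair (allFin k)) (length-tabulate id))
    (Unique-⊆⇒length≤ (Uniqueₚ.map⁺ pair-injective (Uniqueₚ.allFin⁺ k)) pairs⊆nonEdges)
  where
  partner : Fin (suc k) → Fin (suc k)
  partner x = if adj G x a then b else a

  partner-nonadjacent : ∀ x → x ≢ a → x ≢ partner x × ¬ Adj G x (partner x)
  partner-nonadjacent x x≢a with adj G x a in x~a
  ... | true  = (λ { refl → a≁b (Adj-sym {G = G} x~a′) }) , λ x~b → lonely (x , Adj-sym {G = G} x~a′ , x~b)
    where x~a′ = subst T (≡.sym x~a) tt
  ... | false = x≢a , subst T x~a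

  partner-≡b : ∀ {x y} → x ≢ a → x ≡ partner y → x ≡ b
  partner-≡b {y = y} x≢a x≡py with adj G y a
  ... | true  = x≡py
  ... | false = ⊥-elim (x≢a x≡py)

  pair : Fin k → Fin (suc k) × Fin (suc k)
  pair i = sortPair (punchIn a i) (partner (punchIn a i))

  pair-injective : ∀ {i j} → pair i ≡ pair j → i ≡ j
  pair-injective {i} {j} eq with sortPair-injective eq
  ... | inj₁ (x≡y , _)      = Finₚ.punchIn-injective a i j x≡y
  ... | inj₂ (x≡py , px≡y) = Finₚ.punchIn-injective a i j
    (trans (partner-≡b (Finₚ.punchInᵢ≢i a i) x≡py) (≡.sym (partner-≡b (Finₚ.punchInᵢ≢i a j) (≡.sym px≡y))))

  pairs⊆nonEdges : map pair (allFin k) ⊆ nonEdges G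
  pairs⊆nonEdges e∈ with ∈-map⁻ pair e∈
  ... | i , _ , refl with partner-nonadjacent (punchIn a i) (Finₚ.punchInᵢ≢i a i)
  ...   | x≢px , x≁px = sortPair-∈-pairsWhere (nonadj-sym G) x≢px (T-not⁺ x≁px)

few-nonEdges⇒diameterTwo : ∀ {n} (G : Graph n) → length (nonEdges G) < n ∸ 1 → DiameterAtMostTwo G
few-nonEdges⇒diameterTwo G few {a} {b} a≢b a≁b with Finₚ.any? (λ w → T? (adj G a w) ×-dec T? (adj G w b))
... | yes common = common
... | no  lonely = ⊥-elim (<⇒≱ few (far⇒n∸1≤nonEdges G a≢b a≁b lonely))

N∸p+l≡N⇒l≤p : ∀ {N p l} → N ∸ p + l ≡ N → l ≤ p
N∸p+l≡N⇒l≤p {N} {p} {l} eq = +-cancelˡ-≤ (N ∸ p) l p (begin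
  N ∸ p + l ≡⟨ eq ⟩
  N         ≤⟨ m≤n+m∸n N p ⟩
  p + (N ∸ p) ≡⟨ +-comm p (N ∸ p) ⟩
  N ∸ p + p ∎)
  where open ≤-Reasoning

N∸2p≤c : ∀ {N p m c x} → m ≡ N ∸ p → m ≤ c + x → x ≤ p → N ∸ 2 * p ≤ c
N∸2p≤c {N} {p} {m} {c} {x} m≡N∸p m≤c+x x≤p = begin
  N ∸ 2 * p     ≡⟨ cong (N ∸_) (cong (p +_) (+-identityʳ p)) ⟩
  N ∸ (p + p)   ≡⟨ ∸-+-assoc N p p ⟨
  N ∸ p ∸ p     ≡⟨ cong (_∸ p) m≡N∸p ⟨
  m ∸ p         ≤⟨ ∸-monoʳ-≤ m x≤p ⟩
  m ∸ x         ≤⟨ m≤n+o⇒m∸n≤o m x (subst (m ≤_) (+-comm c x) m≤c+x) ⟩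
  c ∎
  where open ≤-Reasoning

lemma2 : (n p : ℕ) → p ≤ (n ∸ 1) C 2 →
    (G : Graph n) → Connected G → numEdges G ≡ n C 2 ∸ p →
    mc≥ G (n C 2 ∸ 2 * p)
lemma2 n p _ G connected m≡ with n ∸ 1 ≤? p
... | yes n∸1≤p = let c , mc , bound = spanningTreeColouring G connected
                  in c , mc , N∸2p≤c m≡ bound n∸1≤p
... | no  n∸1≰p = let c , mc , bound = diameterTwoColouring G (few-nonEdges⇒diameterTwo G few)
                  in c , mc , N∸2p≤c m≡ bound nonEdges≤p
  where
  nonEdges≤p : length (nonEdges G) ≤ p
  nonEdges≤p = N∸p+l≡N⇒l≤p (trans (cong (_+ length (nonEdges G)) (≡.sym m≡)) (numEdges+nonEdges G))
  few : length (nonEdges G) < n ∸ 1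
  few = ≤-<-trans nonEdges≤p (≰⇒> n∸1≰p)
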